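{- Let $G$ be an autonomous OSP-graph and let $x$ be a positive integer smaller than every vertex of $G$. Then $x\oplus G$ is autonomous.
   Context: A simple pseudo-graph is a finite graph that may have loops but no multiple edges; its edge set $E(G)\subseteq V(G)\times V(G)$ is a symmetric relation, and $v$ is looped iff $vv\in E(G)$. Write $N(v)=\{w: vw\in E(G)\}$ and $\mathcal{L}(G)$ for the set of looped vertices. An OSP-graph is a simple pseudo-graph whose vertex set is a finite set of positive integers with the usual order. Pressing a looped vertex $v$ produces $G_{(v)}$ with vertex set $V(G)$ and edge set $E(G)\,\triangle\,(N(v)\times N(v))$; $G_{(v_1,\dots,v_k)}$ denotes successive pressing. A successful pressing sequence is a sequence $(v_1,\dots,v_k)$ with each $v_i$ looped in $G_{(v_1,\dots,v_{i-1})}$ and $G_{(v_1,\dots,v_k)}$ having no edges and no loops; $\Sigma(G)$ is their set. $G$ is full-rank if its adjacency matrix (diagonal entry $1$ at looped vertices) is invertible over $\mathbb{F}_2$. For full-rank $G$ on $n$ vertices and $\sigma=(v_1,\dots,v_n)\in\Sigma(G)$, let $U$ be the upper-triangular $0/1$ matrix with $U[i,j]=1$ iff $i\le j$ and $v_iv_j\in E(G_{(v_1,\dots,v_{i-1})})$, $D$ the digraph on $V(G)$ with arc $v_i\to v_j$ whenever $U[i,j]=1$, and $\mathcal{P}(G,\sigma)=(V(G),\preceq)$ the poset with $y\preceq x$ iff there is a directed path (possibly of length $0$) from $x$ to $y$ in $D$. $\mathcal{P}(G)$ denotes $\mathcal{P}(G,\sigma)$ for $\sigma$ the increasing order of $V(G)$.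 A linear extension of a poset is a listing $(\tau_1,\dots,\tau_n)$ of its elements with $\tau_i\succ\tau_j\Rightarrow i<j$; $\mathrm{LinExt}(\mathcal{P})$ is their set. A full-rank OSP-graph $G$ is autonomous if the increasing order of $V(G)$ belongs to $\Sigma(G)$ and $\Sigma(G)=\mathrm{LinExt}(\mathcal{P}(G))$. For $x\notin V(G)$, $x\oplus G$ is the OSP-graph with vertex set $V(G)\cup\{x\}$ and edge set $E(G)\,\triangle\,(S\times S)$ where $S=\mathcal{L}(G)\cup\{x\}$; thus $\mathcal{L}(x\oplus G)=\{x\}$ and pressing $x$ in $x\oplus G$ and deleting $x$ returns $G$. -}

module Defs where

open import Data.Bool using (Bool; true; false; _xor_; _∧_; _∨_)
open import Data.Nat using (ℕ; zero; suc; _<_; _≤_; _≡ᵇ_)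
open import Data.Fin as Fin using (Fin)
open import Data.List using (List; []; _∷_; length; lookup; take)
open import Data.List.Membership.Propositional using (_∈_)
open import Data.List.Relation.Unary.All using (All)
open import Data.List.Relation.Unary.Linked using (Linked)
open import Data.List.Relation.Binary.Permutation.Propositional using (_↭_)
open import Relation.Binary.Construct.Closure.ReflexiveTransitive using (Star)
open import Data.Product using (Σ; ∃; _×_; _,_)
open import Data.Unit using (⊤)
open import Relation.Binary.PropositionalEquality using (_≡_; _≢_)
open import Relation.Nullary.Decidable using (⌊_⌋)

-- Edge relation of a simple pseudo-graph, as a Boolean-valued relation on ℕ.
-- uv ∈ E  iff  E u v ≡ true ; v is looped iff E v v ≡ true.
Edges : Set
Edges = ℕ → ℕ → Bool

-- An OSP-graph: vertex set a finite set of positive integers, represented by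
-- its strictly increasing listing V; edges symmetric and contained in V × V.
record IsOSPGraph (V : List ℕ) (E : Edges) : Set where
  field
    increasing : Linked _<_ V
    positive   : All (1 ≤_) V
    symmetric  : ∀ u w → E u w ≡ E w u
    support    : ∀ u w → E u w ≡ true → (u ∈ V) × (w ∈ V)

Looped : Edges → ℕ → Set
Looped E v = E v v ≡ true

press : Edges → ℕ → Edges
press E v u w = E u w xor (E v u ∧ E v w)

pressSeq : Edges → List ℕ → Edges
pressSeq E []      = E
pressSeq E (v ∷ σ) = pressSeq (press E v) σ

ValidPressing : Edges → List ℕ → Set
ValidPressing E []      = ⊤
ValidPressing E (v ∷ σ) = Looped E v × ValidPressing (press E v) σ

Successful : Edges → List ℕ → Set
Successful E σ = ValidPressing E σ × (∀ u w → pressSeq E σ u w ≡ false)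

-- Matrices over F₂ = Bool (xor, ∧)
Matrix : ℕ → Set
Matrix n = Fin n → Fin n → Bool

xorSum : ∀ n → (Fin n → Bool) → Bool
xorSum zero    f = false
xorSum (suc n) f = f Fin.zero xor xorSum n (λ i → f (Fin.suc i))

mul : ∀ {n} → Matrix n → Matrix n → Matrix n
mul {n} A B i j = xorSum n (λ k → A i k ∧ B k j)

idM : ∀ {n} → Matrix n
idM i j = ⌊ i Fin.≟ j ⌋

adjMatrix : (V : List ℕ) → Edges → Matrix (length V)
adjMatrix V E i j = E (lookup V i) (lookup V j)

FullRank : List ℕ → Edges → Set
FullRank V E = Σ (Matrix (length V)) λ B →
  (∀ i j → mul (adjMatrix V E) B i j ≡ idM i j) ×
  (∀ i j → mul B (adjMatrix V E) i j ≡ idM i j)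

-- Arcs of the digraph D for (G, σ): v_i → v_j when i ≤ j and
-- v_i v_j ∈ E(G_(v_1,…,v_{i-1}))   (indices 0-based here: take i σ)
Arc : Edges → (σ : List ℕ) → ℕ → ℕ → Set
Arc E σ x y = Σ (Fin (length σ)) λ i → Σ (Fin (length σ)) λ j →
  (i Fin.≤ j) × (lookup σ i ≡ x) × (lookup σ j ≡ y) ×
  (pressSeq E (take (Fin.toℕ i) σ) x y ≡ true)

-- y ⪯ x in 𝒫(G,σ) iff there is a directed path from x to y in D
Below : Edges → List ℕ → ℕ → ℕ → Set
Below E σ y x = Star (Arc E σ) x y

Above : Edges → List ℕ → ℕ → ℕ → Set
Above E σ x y = Below E σ y x × (x ≢ y)

-- τ ∈ LinExt(𝒫(G)), 𝒫(G) = 𝒫(G, increasing order of V) = 𝒫(G, V)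
LinExt : List ℕ → Edges → List ℕ → Set
LinExt V E τ = (τ ↭ V) ×
  (∀ (i j : Fin (length τ)) → Above E V (lookup τ i) (lookup τ j) → i Fin.< j)

Autonomous : List ℕ → Edges → Set
Autonomous V E =
  IsOSPGraph V E × FullRank V E × Successful E V ×
  (∀ τ → (Successful E τ → LinExt V E τ) × (LinExt V E τ → Successful E τ))

-- x ⊕ G : edges E △ (S × S), S = 𝓛(G) ∪ {x}; vertex list x ∷ V
oplusE : ℕ → Edges → Edges
oplusE x E u w = E u w xor (inS u ∧ inS w)
  where
  inS : ℕ → Bool
  inS v = (v ≡ᵇ x) ∨ E v v

module Submission where

-- Since x is not a vertex of G, pressing x in x ⊕ G gives back G, and x is the only looped
-- vertex of x ⊕ G; so the successful pressing sequences of x ⊕ G are x followed by one of G.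
-- In the digraph of x ⊕ G the arcs among vertices of G are those of G, nothing enters x,
-- and every vertex v of G is reachable from x: if v is looped in G it is adjacent to x,
-- otherwise v must become looped before it is pressed, which happens only when an earlier
-- pressed vertex is adjacent to it, and induction applies. Hence x is the top of 𝒫(x ⊕ G)
-- and its linear extensions are x followed by those of 𝒫(G). Full rank holds because the
-- adjacency matrix of x ⊕ G is obtained from that of G by an invertible congruence.

open import Defs
open import Algebra.Bundles using (CommutativeRing)
open import Data.Bool using (Bool; true; false; not; _xor_; _∧_; _∨_)
open import Data.Bool.Properties
  using ( xor-∧-commutativeRing; ∧-comm; ∧-assoc; ∧-idem; ∧-zeroʳ; ∧-identityʳ
        ; ∧-distribˡ-xor; ∧-distribʳ-xor; xor-assoc; xor-comm; xor-same; xor-identityʳ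
        ; xor-inverseˡ; ¬-not; not-¬ )
open import Data.Fin as Fin using (Fin; zero; suc; toℕ)
open import Data.Fin.Induction using (<-wellFounded)
open import Data.Fin.Properties using (suc-injective)
open import Data.List using (List; []; _∷_; length; lookup; take)
open import Data.List.Membership.Propositional using (_∈_; _∉_)
open import Data.List.Membership.Propositional.Properties using (∈-lookup)
open import Data.List.Relation.Binary.Permutation.Propositional using (prep; ↭-sym)
open import Data.List.Relation.Binary.Permutation.Propositional.Properties
  using (∈-resp-↭; ¬x∷xs↭[]; drop-∷)
open import Data.List.Relation.Unary.All as All using (All; []; _∷_)
open import Data.List.Relation.Unary.Any as Any using (index; here; there)
open import Data.List.Relation.Unary.Any.Properties using (lookup-index)
open import Data.List.Relation.Unary.Linked using (Linked; [-]; _∷_)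
open import Data.Nat as ℕ using (ℕ; zero; suc; _<_; _≤_; s≤s; z≤n; _≡ᵇ_)
open import Data.Nat.Properties using (<⇒≤; ≤-pred; <-irrefl)
open import Data.Product using (Σ; ∃; _×_; _,_; proj₁; proj₂; map₁)
open import Data.Sum using (_⊎_; inj₁; inj₂)
open import Data.Unit using (tt)
open import Function using (_∘_)
open import Induction.WellFounded using (Acc; acc)
open import Relation.Binary.Construct.Closure.ReflexiveTransitive as Star using (ε; _◅_; _◅◅_)
open import Relation.Binary.PropositionalEquality
open import Relation.Nullary using (contradiction; yes; no)
open import Relation.Nullary.Decidable using (⌊⌋-map′; dec-true; dec-false)
open import Algebra.Properties.Semiring.Sum (CommutativeRing.semiring xor-∧-commutativeRing)
  using (sum; sum-cong-≗; sum-replicate-zero; ∑-distrib-+; ∑-comm; *-distribˡ-sum; *-distribʳ-sum)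

-- Linear algebra over F₂

xor-cancel-outer : ∀ a b → a xor (b xor a) ≡ b
xor-cancel-outer a b = begin
  a xor (b xor a)  ≡⟨ cong (a xor_) (xor-comm b a) ⟩
  a xor (a xor b)  ≡⟨ xor-assoc a a b ⟨
  (a xor a) xor b  ≡⟨ cong (_xor b) (xor-same a) ⟩
  b                ∎
  where open ≡-Reasoning

∧-not-xor-∧ : ∀ a c → (a ∧ not c) xor (a xor (a ∧ c)) ≡ false
∧-not-xor-∧ false c     = refl
∧-not-xor-∧ true  false = refl
∧-not-xor-∧ true  true  = refl

xorSum≡sum : ∀ n (f : Fin n → Bool) → xorSum n f ≡ sum f
xorSum≡sum zero    f = refl
xorSum≡sum (suc n) f = cong (f zero xor_) (xorSum≡sum n (λ k → f (suc k)))

dot : ∀ {n} → (Fin n → Bool) → (Fin n → Bool) → Bool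
dot f g = sum (λ k → f k ∧ g k)

col : ∀ {n} → Matrix n → Fin n → Fin n → Bool
col M j k = M k j

mul≡dot : ∀ {n} (A B : Matrix n) i j → mul A B i j ≡ dot (A i) (col B j)
mul≡dot {n} A B i j = xorSum≡sum n _

idM-suc : ∀ {n} (i j : Fin n) → idM (suc i) (suc j) ≡ idM i j
idM-suc i j = ⌊⌋-map′ (cong suc) suc-injective (i Fin.≟ j)

dot-idˡ : ∀ {n} (i : Fin n) (f : Fin n → Bool) → dot (idM i) f ≡ f i
dot-idˡ {suc n} zero    f =
  trans (cong (f zero xor_) (sum-replicate-zero n)) (xor-identityʳ (f zero))
dot-idˡ {suc n} (suc i) f =
  trans (sum-cong-≗ (λ k → cong (_∧ f (suc k)) (idM-suc i k))) (dot-idˡ i (λ k → f (suc k)))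

dot-idʳ : ∀ {n} (f : Fin n → Bool) (j : Fin n) → dot f (col idM j) ≡ f j
dot-idʳ {suc n} f zero = begin
  (f zero ∧ true) xor sum (λ k → f (suc k) ∧ false)
    ≡⟨ cong₂ _xor_ (∧-identityʳ (f zero)) (sum-cong-≗ (λ k → ∧-zeroʳ (f (suc k)))) ⟩
  f zero xor sum {n} (λ _ → false)
    ≡⟨ cong (f zero xor_) (sum-replicate-zero n) ⟩
  f zero xor false
    ≡⟨ xor-identityʳ (f zero) ⟩
  f zero ∎
  where open ≡-Reasoning
dot-idʳ {suc n} f (suc j) = begin
  (f zero ∧ false) xor sum (λ k → f (suc k) ∧ idM (suc k) (suc j))
    ≡⟨ cong₂ _xor_ (∧-zeroʳ (f zero)) (sum-cong-≗ (λ k → cong (f (suc k) ∧_) (idM-suc k j))) ⟩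
  dot (λ k → f (suc k)) (col idM j)
    ≡⟨ dot-idʳ (λ k → f (suc k)) j ⟩
  f (suc j) ∎
  where open ≡-Reasoning

dot-xorˡ-scaled : ∀ {n} (f g h : Fin n → Bool) a →
  dot (λ k → f k xor (a ∧ g k)) h ≡ dot f h xor (a ∧ dot g h)
dot-xorˡ-scaled f g h a = begin
  dot (λ k → f k xor (a ∧ g k)) h
    ≡⟨ sum-cong-≗ (λ k → trans (∧-distribʳ-xor (h k) (f k) _)
                               (cong ((f k ∧ h k) xor_) (∧-assoc a (g k) (h k)))) ⟩
  sum (λ k → (f k ∧ h k) xor (a ∧ (g k ∧ h k)))
    ≡⟨ ∑-distrib-+ (λ k → f k ∧ h k) (λ k → a ∧ (g k ∧ h k)) ⟩
  dot f h xor sum (λ k → a ∧ (g k ∧ h k))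
    ≡⟨ cong (dot f h xor_) (sym (*-distribˡ-sum a (λ k → g k ∧ h k))) ⟩
  dot f h xor (a ∧ dot g h) ∎
  where open ≡-Reasoning

dot-xorʳ-scaled : ∀ {n} (h f g : Fin n → Bool) a →
  dot h (λ k → f k xor (g k ∧ a)) ≡ dot h f xor (dot h g ∧ a)
dot-xorʳ-scaled h f g a = begin
  dot h (λ k → f k xor (g k ∧ a))
    ≡⟨ sum-cong-≗ (λ k → trans (∧-distribˡ-xor (h k) (f k) _)
                               (cong ((h k ∧ f k) xor_) (sym (∧-assoc (h k) (g k) a)))) ⟩
  sum (λ k → (h k ∧ f k) xor ((h k ∧ g k) ∧ a))
    ≡⟨ ∑-distrib-+ (λ k → h k ∧ f k) (λ k → (h k ∧ g k) ∧ a) ⟩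
  dot h f xor sum (λ k → (h k ∧ g k) ∧ a)
    ≡⟨ cong (dot h f xor_) (sym (*-distribʳ-sum a (λ k → h k ∧ g k))) ⟩
  dot h f xor (dot h g ∧ a) ∎
  where open ≡-Reasoning

dot-assoc : ∀ {n} (f : Fin n → Bool) (M : Matrix n) (g : Fin n → Bool) →
  dot (λ k → dot f (col M k)) g ≡ dot f (λ l → dot (M l) g)
dot-assoc f M g = begin
  sum (λ k → sum (λ l → f l ∧ M l k) ∧ g k)
    ≡⟨ sum-cong-≗ (λ k → *-distribʳ-sum (g k) (λ l → f l ∧ M l k)) ⟩
  sum (λ k → sum (λ l → (f l ∧ M l k) ∧ g k))
    ≡⟨ ∑-comm (λ k l → (f l ∧ M l k) ∧ g k) ⟩
  sum (λ l → sum (λ k → (f l ∧ M l k) ∧ g k))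
    ≡⟨ sum-cong-≗ (λ l → trans (sum-cong-≗ (λ k → ∧-assoc (f l) (M l k) (g k)))
                               (sym (*-distribˡ-sum (f l) (λ k → M l k ∧ g k)))) ⟩
  sum (λ l → f l ∧ sum (λ k → M l k ∧ g k)) ∎
  where open ≡-Reasoning

IsInverse : ∀ {n} → Matrix n → Matrix n → Set
IsInverse A B = (∀ i j → mul A B i j ≡ idM i j) × (∀ i j → mul B A i j ≡ idM i j)

Invertible : ∀ {n} → Matrix n → Set
Invertible {n} A = Σ (Matrix n) (IsInverse A)

_≗ᴹ_ : ∀ {n} → Matrix n → Matrix n → Set
A ≗ᴹ A′ = ∀ i j → A i j ≡ A′ i j

mul-congˡ : ∀ {n} {A A′ : Matrix n} → A ≗ᴹ A′ → ∀ B i j → mul A B i j ≡ mul A′ B i j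
mul-congˡ {A = A} {A′} A≗A′ B i j = begin
  mul A B i j           ≡⟨ mul≡dot A B i j ⟩
  dot (A i) (col B j)   ≡⟨ sum-cong-≗ (λ k → cong (_∧ B k j) (A≗A′ i k)) ⟩
  dot (A′ i) (col B j)  ≡⟨ mul≡dot A′ B i j ⟨
  mul A′ B i j          ∎
  where open ≡-Reasoning

mul-congʳ : ∀ {n} {A A′ : Matrix n} → A ≗ᴹ A′ → ∀ B i j → mul B A i j ≡ mul B A′ i j
mul-congʳ {A = A} {A′} A≗A′ B i j = begin
  mul B A i j            ≡⟨ mul≡dot B A i j ⟩
  dot (B i) (col A j)    ≡⟨ sum-cong-≗ (λ k → cong (B i k ∧_) (A≗A′ k j)) ⟩
  dot (B i) (col A′ j)   ≡⟨ mul≡dot B A′ i j ⟨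
  mul B A′ i j           ∎
  where open ≡-Reasoning

invertible-resp-≗ᴹ : ∀ {n} {A A′ : Matrix n} → A ≗ᴹ A′ → Invertible A → Invertible A′
invertible-resp-≗ᴹ A≗A′ (B , AB≡I , BA≡I) =
  B , (λ i j → trans (sym (mul-congˡ A≗A′ B i j)) (AB≡I i j))
    , (λ i j → trans (sym (mul-congʳ A≗A′ B i j)) (BA≡I i j))

border : ∀ {n} → Bool → (Fin n → Bool) → (Fin n → Bool) → Matrix n → Matrix (suc n)
border a r c M zero    zero    = a
border a r c M zero    (suc j) = r j
border a r c M (suc i) zero    = c i
border a r c M (suc i) (suc j) = M i j

-- [[1, sᵀ], [s, A + s sᵀ]] = L (1 ⊕ A) Lᵀ with L = [[1, 0], [s, I]] = L⁻¹ over F₂,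
-- which gives the inverse [[1 + sᵀ B s, sᵀ B], [B s, B]].
module _ {n} {A B : Matrix n} (inverse : IsInverse A B) (s : Fin n → Bool) where

  private
    A·B≡I : ∀ i j → dot (A i) (col B j) ≡ idM i j
    A·B≡I i j = trans (sym (mul≡dot A B i j)) (proj₁ inverse i j)

    B·A≡I : ∀ i j → dot (B i) (col A j) ≡ idM i j
    B·A≡I i j = trans (sym (mul≡dot B A i j)) (proj₂ inverse i j)

    u t : Fin n → Bool
    u i = dot (B i) s
    t j = dot s (col B j)

    c : Bool
    c = dot s u

  Au≡s : ∀ i → dot (A i) u ≡ s i
  Au≡s i = begin
    dot (A i) (λ l → dot (B l) s)    ≡⟨ dot-assoc (A i) B s ⟨
    dot (λ k → dot (A i) (col B k)) s ≡⟨ sum-cong-≗ (λ k → cong (_∧ s k) (A·B≡I i k)) ⟩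
    dot (idM i) s                    ≡⟨ dot-idˡ i s ⟩
    s i                              ∎
    where open ≡-Reasoning

  tA≡s : ∀ j → dot t (col A j) ≡ s j
  tA≡s j = begin
    dot (λ k → dot s (col B k)) (col A j) ≡⟨ dot-assoc s B (col A j) ⟩
    dot s (λ l → dot (B l) (col A j))     ≡⟨ sum-cong-≗ (λ l → cong (s l ∧_) (B·A≡I l j)) ⟩
    dot s (col idM j)                     ≡⟨ dot-idʳ s j ⟩
    s j                                   ∎
    where open ≡-Reasoning

  ts≡c : dot t s ≡ c
  ts≡c = dot-assoc s B s

  private
    A′ B′ : Matrix (suc n)
    A′ = border true s s (λ i j → A i j xor (s i ∧ s j))
    B′ = border (not c) t u B

  A′B′≡I : ∀ i j → dot (A′ i) (col B′ j) ≡ idM i j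
  A′B′≡I zero    zero    = xor-inverseˡ c
  A′B′≡I zero    (suc j) = xor-same (t j)
  A′B′≡I (suc i) zero    = begin
    (s i ∧ not c) xor dot (λ k → A i k xor (s i ∧ s k)) u
      ≡⟨ cong ((s i ∧ not c) xor_) (dot-xorˡ-scaled (A i) s u (s i)) ⟩
    (s i ∧ not c) xor (dot (A i) u xor (s i ∧ c))
      ≡⟨ cong (λ a → (s i ∧ not c) xor (a xor (s i ∧ c))) (Au≡s i) ⟩
    (s i ∧ not c) xor (s i xor (s i ∧ c))
      ≡⟨ ∧-not-xor-∧ (s i) c ⟩
    false ∎
    where open ≡-Reasoning
  A′B′≡I (suc i) (suc j) = begin
    (s i ∧ t j) xor dot (λ k → A i k xor (s i ∧ s k)) (col B j)
      ≡⟨ cong ((s i ∧ t j) xor_) (dot-xorˡ-scaled (A i) s (col B j) (s i)) ⟩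
    (s i ∧ t j) xor (dot (A i) (col B j) xor (s i ∧ t j))
      ≡⟨ xor-cancel-outer (s i ∧ t j) _ ⟩
    dot (A i) (col B j)
      ≡⟨ A·B≡I i j ⟩
    idM i j
      ≡⟨ idM-suc i j ⟨
    idM (suc i) (suc j) ∎
    where open ≡-Reasoning

  B′A′≡I : ∀ i j → dot (B′ i) (col A′ j) ≡ idM i j
  B′A′≡I zero    zero    = trans (cong₂ _xor_ (∧-identityʳ (not c)) ts≡c) (xor-inverseˡ c)
  B′A′≡I zero    (suc j) = begin
    (not c ∧ s j) xor dot t (λ k → A k j xor (s k ∧ s j))
      ≡⟨ cong ((not c ∧ s j) xor_) (dot-xorʳ-scaled t (col A j) s (s j)) ⟩
    (not c ∧ s j) xor (dot t (col A j) xor (dot t s ∧ s j))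
      ≡⟨ cong₂ (λ a b → (not c ∧ s j) xor (a xor (b ∧ s j))) (tA≡s j) ts≡c ⟩
    (not c ∧ s j) xor (s j xor (c ∧ s j))
      ≡⟨ cong₂ (λ a b → a xor (s j xor b)) (∧-comm (not c) (s j)) (∧-comm c (s j)) ⟩
    (s j ∧ not c) xor (s j xor (s j ∧ c))
      ≡⟨ ∧-not-xor-∧ (s j) c ⟩
    false ∎
    where open ≡-Reasoning
  B′A′≡I (suc i) zero    = trans (cong (_xor u i) (∧-identityʳ (u i))) (xor-same (u i))
  B′A′≡I (suc i) (suc j) = begin
    (u i ∧ s j) xor dot (B i) (λ k → A k j xor (s k ∧ s j))
      ≡⟨ cong ((u i ∧ s j) xor_) (dot-xorʳ-scaled (B i) (col A j) s (s j)) ⟩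
    (u i ∧ s j) xor (dot (B i) (col A j) xor (u i ∧ s j))
      ≡⟨ xor-cancel-outer (u i ∧ s j) _ ⟩
    dot (B i) (col A j)
      ≡⟨ B·A≡I i j ⟩
    idM i j
      ≡⟨ idM-suc i j ⟨
    idM (suc i) (suc j) ∎
    where open ≡-Reasoning

  border-invertible : Invertible A′
  border-invertible = B′ , (λ i j → trans (mul≡dot A′ B′ i j) (A′B′≡I i j))
                         , (λ i j → trans (mul≡dot B′ A′ i j) (B′A′≡I i j))

-- Pressing sequences

infix 4 _≐_
_≐_ : Edges → Edges → Set
F ≐ G = ∀ u w → F u w ≡ G u w

press-cong : ∀ {F G} → F ≐ G → ∀ v → press F v ≐ press G v
press-cong F≐G v u w = cong₂ _xor_ (F≐G u w) (cong₂ _∧_ (F≐G v u) (F≐G v w))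

pressSeq-cong : ∀ {F G} → F ≐ G → ∀ σ → pressSeq F σ ≐ pressSeq G σ
pressSeq-cong F≐G []      = F≐G
pressSeq-cong F≐G (v ∷ σ) = pressSeq-cong (press-cong F≐G v) σ

validPressing-cong : ∀ {F G} → F ≐ G → ∀ σ → ValidPressing F σ → ValidPressing G σ
validPressing-cong F≐G []      tt               = tt
validPressing-cong F≐G (v ∷ σ) (looped , valid) =
  trans (sym (F≐G v v)) looped , validPressing-cong (press-cong F≐G v) σ valid

successful-cong : ∀ {F G} → F ≐ G → ∀ σ → Successful F σ → Successful G σ
successful-cong F≐G σ (valid , empty) =
  validPressing-cong F≐G σ valid , λ u w → trans (sym (pressSeq-cong F≐G σ u w)) (empty u w)

looped-when-pressed : ∀ {F} σ → ValidPressing F σ → ∀ j →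
  Looped (pressSeq F (take (toℕ j) σ)) (lookup σ j)
looped-when-pressed (v ∷ σ) (looped , valid) zero    = looped
looped-when-pressed (v ∷ σ) (looped , valid) (suc j) = looped-when-pressed σ valid j

loop-created-by-neighbour : ∀ {F v} σ n → F v v ≡ false → Looped (pressSeq F (take n σ)) v →
  Σ (Fin (length σ)) λ i → toℕ i < n × pressSeq F (take (toℕ i) σ) (lookup σ i) v ≡ true
loop-created-by-neighbour σ  zero    unlooped looped = contradiction looped (not-¬ unlooped)
loop-created-by-neighbour [] (suc n) unlooped looped = contradiction looped (not-¬ unlooped)
loop-created-by-neighbour {F} {v} (u ∷ σ) (suc n) unlooped looped with F u v in uv
... | true  = zero , s≤s z≤n , uv
... | false with loop-created-by-neighbour σ n still-unlooped looped
  where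
  still-unlooped : press F u v v ≡ false
  still-unlooped rewrite unlooped | uv = refl
...   | i , i<n , edge = suc i , s≤s i<n , edge

pressSeq-preserves-no-edge-to : ∀ {F x} → (∀ u → F u x ≡ false) →
  ∀ σ u → pressSeq F σ u x ≡ false
pressSeq-preserves-no-edge-to         no-edge []      = no-edge
pressSeq-preserves-no-edge-to {F} {x} no-edge (v ∷ σ) =
  pressSeq-preserves-no-edge-to still-no-edge σ
  where
  still-no-edge : ∀ u → press F v u x ≡ false
  still-no-edge u rewrite no-edge u | no-edge v = ∧-zeroʳ (F v u)

-- The graph x ⊕ G

xor-∧-true : ∀ a b c → a xor (b ∧ c) ≡ true → a ≡ true ⊎ (b ≡ true × c ≡ true)
xor-∧-true true  b     c     _ = inj₁ refl
xor-∧-true false true  true  _ = inj₂ (refl , refl)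

-- The decision bit of ℕ._≟_ is _≡ᵇ_ itself.
≡ᵇ-refl : ∀ n → (n ≡ᵇ n) ≡ true
≡ᵇ-refl n = dec-true (n ℕ.≟ n) refl

≢⇒≡ᵇ-false : ∀ {m n} → m ≢ n → (m ≡ᵇ n) ≡ false
≢⇒≡ᵇ-false {m} {n} = dec-false (m ℕ.≟ n)

linked-cons : ∀ {x V} → All (x <_) V → Linked _<_ V → Linked _<_ (x ∷ V)
linked-cons {V = []}    []          _ = [-]
linked-cons {V = _ ∷ _} (x<v ∷ _) increasing = x<v ∷ increasing

oplus-looped⇒≡ : ∀ {E x u} → Looped (oplusE x E) u → u ≡ x
oplus-looped⇒≡ {E} {x} {u} looped with u ℕ.≟ x
... | yes u≡x = u≡x
... | no  u≢x = contradiction looped (not-¬ unlooped)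
  where
  unlooped : oplusE x E u u ≡ false
  unlooped rewrite ≢⇒≡ᵇ-false u≢x | ∧-idem (E u u) = xor-same (E u u)

module Oplus {V E x} (G : IsOSPGraph V E) (x∉V : x ∉ V) where

  open IsOSPGraph G

  private
    E′ : Edges
    E′ = oplusE x E

  ∈V⇒≢x : ∀ {v} → v ∈ V → v ≢ x
  ∈V⇒≢x v∈V refl = x∉V v∈V

  lookup≢x : ∀ j → lookup V j ≢ x
  lookup≢x j = ∈V⇒≢x (∈-lookup j)

  no-edge-from-x : ∀ w → E x w ≡ false
  no-edge-from-x w = ¬-not λ xw → x∉V (proj₁ (support x w xw))

  no-edge-to-x : ∀ u → E u x ≡ false
  no-edge-to-x u = ¬-not λ ux → x∉V (proj₂ (support u x ux))

  oplus-looped : Looped E′ x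
  oplus-looped rewrite no-edge-from-x x | ≡ᵇ-refl x = refl

  oplus-edge-from-x : ∀ {v} → v ≢ x → E′ x v ≡ E v v
  oplus-edge-from-x {v} v≢x rewrite no-edge-from-x v | ≡ᵇ-refl x | ≢⇒≡ᵇ-false v≢x = refl

  oplus-edge-to-x : ∀ {v} → v ≢ x → E′ v x ≡ E v v
  oplus-edge-to-x {v} v≢x rewrite no-edge-to-x v | ≡ᵇ-refl x | ≢⇒≡ᵇ-false v≢x =
    ∧-identityʳ (E v v)

  oplus-edge : ∀ {u w} → u ≢ x → w ≢ x → E′ u w ≡ E u w xor (E u u ∧ E w w)
  oplus-edge u≢x w≢x rewrite ≢⇒≡ᵇ-false u≢x | ≢⇒≡ᵇ-false w≢x = refl

  press-oplus : press E′ x ≐ E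
  press-oplus u w rewrite no-edge-from-x u | no-edge-from-x w | ≡ᵇ-refl x =
    trans (xor-assoc (E u w) S S) (trans (cong (E u w xor_) (xor-same S)) (xor-identityʳ (E u w)))
    where S = ((u ≡ᵇ x) ∨ E u u) ∧ ((w ≡ᵇ x) ∨ E w w)

  pressSeq-oplus : ∀ σ → pressSeq E′ (x ∷ σ) ≐ pressSeq E σ
  pressSeq-oplus = pressSeq-cong press-oplus

  successful-oplus⁺ : ∀ {τ} → Successful E τ → Successful E′ (x ∷ τ)
  successful-oplus⁺ {τ} successful =
    map₁ (oplus-looped ,_) (successful-cong (λ u w → sym (press-oplus u w)) τ successful)

  successful-oplus⁻ : ∀ {τ} → Successful E′ τ → ∃ λ τ′ → τ ≡ x ∷ τ′ × Successful E τ′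
  successful-oplus⁻ {[]}    (_ , empty) = contradiction oplus-looped (not-¬ (empty x x))
  successful-oplus⁻ {u ∷ τ} ((looped , valid) , empty) with oplus-looped⇒≡ {E} {x} looped
  ... | refl = τ , refl , successful-cong press-oplus τ (valid , empty)

  arc-oplus⁺ : ∀ {a b} → Arc E V a b → Arc E′ (x ∷ V) a b
  arc-oplus⁺ {a} {b} (i , j , i≤j , ≡a , ≡b , edge) =
    suc i , suc j , s≤s i≤j , ≡a , ≡b , trans (pressSeq-oplus (take (toℕ i) V) a b) edge

  arc-oplus⁻ : ∀ {a b} → a ≢ x → Arc E′ (x ∷ V) a b → Arc E V a b × b ≢ x
  arc-oplus⁻ a≢x (zero  , _ , _ , x≡a , _) = contradiction (sym x≡a) a≢x
  arc-oplus⁻ {a} {b} a≢x (suc i , suc j , s≤s i≤j , ≡a , ≡b , edge) =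
    (i , j , i≤j , ≡a , ≡b , trans (sym (pressSeq-oplus (take (toℕ i) V) a b)) edge) ,
    λ b≡x → lookup≢x j (trans ≡b b≡x)

  below-oplus⁺ : ∀ {a b} → Below E V b a → Below E′ (x ∷ V) b a
  below-oplus⁺ = Star.map arc-oplus⁺

  below-oplus⁻ : ∀ {a b} → a ≢ x → Below E′ (x ∷ V) b a → Below E V b a
  below-oplus⁻ a≢x ε         = ε
  below-oplus⁻ a≢x (arc ◅ path) with arc-oplus⁻ a≢x arc
  ... | arc′ , c≢x = arc′ ◅ below-oplus⁻ c≢x path

  arc-to-x : ∀ {a} → Arc E′ (x ∷ V) a x → a ≡ x
  arc-to-x (zero  , _ , _ , x≡a , _) = sym x≡a
  arc-to-x {a} (suc i , suc j , _ , _ , _ , edge) =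
    contradiction (trans (sym (pressSeq-oplus σ a x)) edge)
                  (not-¬ (pressSeq-preserves-no-edge-to no-edge-to-x σ a))
    where σ = take (toℕ i) V

  x-maximal : ∀ {a} → Below E′ (x ∷ V) x a → a ≡ x
  x-maximal ε = refl
  x-maximal (arc ◅ path) with x-maximal path
  ... | refl = arc-to-x arc

  module _ (valid : ValidPressing E V) where

    below-x-lookup : ∀ j → Acc Fin._<_ j → Below E′ (x ∷ V) (lookup V j) x
    below-x-lookup j (acc smaller) with E (lookup V j) (lookup V j) in looped
    ... | true  =
      (zero , suc j , z≤n , refl , refl , trans (oplus-edge-from-x (lookup≢x j)) looped) ◅ ε
    ... | false with loop-created-by-neighbour V (toℕ j) looped (looped-when-pressed V valid j)
    ...   | i , i<j , edge =
      below-x-lookup i (smaller i<j) ◅◅ (arc-oplus⁺ (i , j , <⇒≤ i<j , refl , refl , edge) ◅ ε)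

    below-x : ∀ {v} → v ∈ V → Below E′ (x ∷ V) v x
    below-x v∈V = subst (λ v → Below E′ (x ∷ V) v x) (sym (lookup-index v∈V))
      (below-x-lookup (index v∈V) (<-wellFounded (index v∈V)))

  linExt-oplus⁺ : ∀ {τ} → LinExt V E τ → LinExt (x ∷ V) E′ (x ∷ τ)
  linExt-oplus⁺ {τ} (τ↭V , ordered) = prep x τ↭V , ordered′
    where
    τ≢x : ∀ i → lookup τ i ≢ x
    τ≢x i = ∈V⇒≢x (∈-resp-↭ τ↭V (∈-lookup i))
    ordered′ : ∀ i j → Above E′ (x ∷ V) (lookup (x ∷ τ) i) (lookup (x ∷ τ) j) → i Fin.< j
    ordered′ zero    zero    (_ , x≢x)   = contradiction refl x≢x
    ordered′ zero    (suc j) _           = s≤s z≤n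
    ordered′ (suc i) zero    (path , _)  = contradiction (x-maximal path) (τ≢x i)
    ordered′ (suc i) (suc j) (path , ne) = s≤s (ordered i j (below-oplus⁻ (τ≢x i) path , ne))

  linExt-oplus⁻ : ValidPressing E V → ∀ {τ} → LinExt (x ∷ V) E′ τ →
    ∃ λ τ′ → τ ≡ x ∷ τ′ × LinExt V E τ′
  linExt-oplus⁻ valid {[]}    (τ↭ , _)       = contradiction (↭-sym τ↭) ¬x∷xs↭[]
  linExt-oplus⁻ valid {u ∷ τ} (τ↭ , ordered) with u ℕ.≟ x
  ... | yes refl = τ , refl , drop-∷ τ↭ , λ i j above →
    ≤-pred (ordered (suc i) (suc j) (map₁ below-oplus⁺ above))
  ... | no  u≢x  = contradiction (ordered (suc (index x∈τ)) zero x-above-u) λ ()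
    where
    u∈V : u ∈ V
    u∈V = Any.tail u≢x (∈-resp-↭ τ↭ (here refl))
    x∈τ : x ∈ τ
    x∈τ = Any.tail (u≢x ∘ sym) (∈-resp-↭ (↭-sym τ↭) (here refl))
    x-above-u : Above E′ (x ∷ V) (lookup τ (index x∈τ)) u
    x-above-u = subst (λ y → Above E′ (x ∷ V) y u) (lookup-index x∈τ)
      (below-x valid u∈V , λ x≡u → u≢x (sym x≡u))

  fullRank-oplus : FullRank V E → FullRank (x ∷ V) E′
  fullRank-oplus (B , inverse) =
    invertible-resp-≗ᴹ bordered≗adj (border-invertible {A = adjMatrix V E} {B} inverse s)
    where
    s : Fin (length V) → Bool
    s i = E (lookup V i) (lookup V i)
    bordered≗adj :
      border true s s (λ i j → adjMatrix V E i j xor (s i ∧ s j)) ≗ᴹ adjMatrix (x ∷ V) E′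
    bordered≗adj zero    zero    = sym oplus-looped
    bordered≗adj zero    (suc j) = sym (oplus-edge-from-x (lookup≢x j))
    bordered≗adj (suc i) zero    = sym (oplus-edge-to-x (lookup≢x i))
    bordered≗adj (suc i) (suc j) = sym (oplus-edge (lookup≢x i) (lookup≢x j))

  oplus-isOSPGraph : 1 ≤ x → All (x <_) V → IsOSPGraph (x ∷ V) E′
  oplus-isOSPGraph 1≤x x<V = record
    { increasing = linked-cons x<V increasing
    ; positive   = 1≤x ∷ positive
    ; symmetric  = λ u w → cong₂ _xor_ (symmetric u w) (∧-comm (inS u) (inS w))
    ; support    = support′
    }
    where
    inS : ℕ → Bool
    inS v = (v ≡ᵇ x) ∨ E v v
    inS⇒∈ : ∀ {v} → inS v ≡ true → v ∈ x ∷ V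
    inS⇒∈ {v} inS-v with v ℕ.≟ x
    ... | yes v≡x = here v≡x
    ... | no  v≢x =
      there (proj₁ (support v v (trans (cong (_∨ E v v) (sym (≢⇒≡ᵇ-false v≢x))) inS-v)))
    support′ : ∀ u w → E′ u w ≡ true → u ∈ x ∷ V × w ∈ x ∷ V
    support′ u w edge with xor-∧-true (E u w) (inS u) (inS w) edge
    ... | inj₁ uw             = there (proj₁ (support u w uw)) , there (proj₂ (support u w uw))
    ... | inj₂ (inS-u , inS-w) = inS⇒∈ inS-u , inS⇒∈ inS-w

mainTheorem3 : (V : List ℕ) (E : Edges) (x : ℕ) →
    Autonomous V E → 1 ≤ x → All (x <_) V →
    Autonomous (x ∷ V) (oplusE x E)
mainTheorem3 V E x (G , fullRank , successful , Σ≡LinExt) 1≤x x<V =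
  oplus-isOSPGraph 1≤x x<V , fullRank-oplus fullRank , successful-oplus⁺ successful ,
  λ τ → successful⇒linExt τ , linExt⇒successful τ
  where
  x∉V : x ∉ V
  x∉V x∈V = <-irrefl refl (All.lookup x<V x∈V)
  open Oplus G x∉V
  successful⇒linExt : ∀ τ → Successful (oplusE x E) τ → LinExt (x ∷ V) (oplusE x E) τ
  successful⇒linExt τ s with successful-oplus⁻ s
  ... | τ′ , refl , s′ = linExt-oplus⁺ (proj₁ (Σ≡LinExt τ′) s′)
  linExt⇒successful : ∀ τ → LinExt (x ∷ V) (oplusE x E) τ → Successful (oplusE x E) τ
  linExt⇒successful τ l with linExt-oplus⁻ (proj₁ successful) l
  ... | τ′ , refl , l′ = successful-oplus⁺ (proj₂ (Σ≡LinExt τ′) l′)
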